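{- There is a data structure $\mathsf{Counter}$ on a RAM that can be initialized in constant time and supports operations $\mathsf{inc}$ and $\mathsf{mbit}$, each in constant time, with the following semantics: if $v$ is the number of times $\mathsf{inc}(c)$ has been executed since the initialization of $c$, then $\mathsf{mbit}(c)$ returns an integer $j$ such that $2^j\le v\le 2^{j+1}-1$. Moreover, the data structure uses $O(\log(v)^2)$ registers.
   Context: The RAM model: registers hold integers, are zero-initialized (an infinite supply of zero-initialized memory is available), and on an input of size $n$ an arithmetic operation (addition, subtraction, multiplication, comparison) costs the total bit-size of its arguments divided by $\log n$, so that operations on integers bounded by a polynomial in $n$ take constant time. The counter value $v$ may become exponential in $n$. -}

module Defs where

open import Data.Nat using (ℕ; zero; suc; _+_; _*_; _^_; _≤_; _<_; _∸_; pred)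
open import Data.Nat.DivMod using (_/_)
open import Data.Nat.Logarithm using (⌊log₂_⌋; ⌈log₂_⌉)
import Data.Nat as ℕ
open import Data.Integer as ℤ using (ℤ; +_; ∣_∣)
open import Data.List using (List; []; _∷_; _++_; length; deduplicate)
open import Data.Maybe using (Maybe; just; nothing)
open import Data.Product using (_×_; _,_; ∃-syntax)
open import Data.Bool using (Bool; true; false)
open import Relation.Nullary.Decidable using (does)
open import Relation.Binary.PropositionalEquality using (_≡_)

Mem : Set
Mem = ℕ → ℤ

zeroMem : Mem
zeroMem _ = + 0

update : Mem → ℕ → ℤ → Mem
update m a x b with does (a ℕ.≟ b)
... | true  = x
... | false = m b

-- Instruction set.  Register arguments are direct register indices;
-- 'load'/'store' use indirect addressing (address = |M[a]|);
-- jump targets are program-counter values.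
data Instr : Set where
  const : (r : ℕ) (c : ℤ) → Instr
  add   : (r a b : ℕ) → Instr
  sub   : (r a b : ℕ) → Instr
  mul   : (r a b : ℕ) → Instr
  load  : (r a : ℕ) → Instr
  store : (a b : ℕ) → Instr
  jlt   : (a b t : ℕ) → Instr
  jmp   : (t : ℕ) → Instr
  halt  : Instr

Program : Set
Program = List Instr

nth : Program → ℕ → Maybe Instr
nth []       _       = nothing
nth (i ∷ is) zero    = just i
nth (i ∷ is) (suc k) = nth is k

bits : ℤ → ℕ
bits x = ⌈log₂ (suc ∣ x ∣) ⌉

-- log n, the word-size unit on inputs of size n (equals ⌊log₂ n⌋ for n ≥ 2).
logn : ℕ → ℕ
logn n = suc (pred ⌊log₂ n ⌋)

opCost : ℕ → ℕ → ℕ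
opCost n s = 1 + s / logn n

record StepResult : Set where
  constructor stepResult
  field
    mem'    : Mem
    pc'     : ℕ
    cost    : ℕ
    written : List ℕ

step : ℕ → Instr → ℕ → Mem → StepResult
step n (const r c) pc m = stepResult (update m r c) (suc pc) (opCost n (bits c)) (r ∷ [])
step n (add r a b) pc m =
  stepResult (update m r (m a ℤ.+ m b)) (suc pc) (opCost n (bits (m a) + bits (m b))) (r ∷ [])
step n (sub r a b) pc m =
  stepResult (update m r (m a ℤ.- m b)) (suc pc) (opCost n (bits (m a) + bits (m b))) (r ∷ [])
step n (mul r a b) pc m =
  stepResult (update m r (m a ℤ.* m b)) (suc pc) (opCost n (bits (m a) + bits (m b))) (r ∷ [])
step n (load r a) pc m =
  stepResult (update m r (m ∣ m a ∣)) (suc pc) (opCost n (bits (m a) + bits (m ∣ m a ∣))) (r ∷ [])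
step n (store a b) pc m =
  stepResult (update m ∣ m a ∣ (m b)) (suc pc) (opCost n (bits (m a) + bits (m b))) (∣ m a ∣ ∷ [])
step n (jlt a b t) pc m with does (m a ℤ.<? m b)
... | true  = stepResult m t (opCost n (bits (m a) + bits (m b))) []
... | false = stepResult m (suc pc) (opCost n (bits (m a) + bits (m b))) []
step n (jmp t) pc m = stepResult m t 1 []
step n halt pc m = stepResult m pc 0 []

record Outcome : Set where
  constructor outcome
  field
    finalMem  : Mem
    totalCost : ℕ
    writes    : List ℕ

addOutcome : ℕ → List ℕ → Maybe Outcome → Maybe Outcome
addOutcome c w nothing = nothing
addOutcome c w (just (outcome m c' w')) = just (outcome m (c + c') (w ++ w'))

exec : (n : ℕ) → Program → (fuel : ℕ) → (pc : ℕ) → Mem → Maybe Outcome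
exec n P zero pc m = nothing
exec n P (suc f) pc m with nth P pc
... | nothing   = just (outcome m 0 [])
... | just halt = just (outcome m 0 [])
... | just i    = let open StepResult (step n i pc m) in
                  addOutcome cost written (exec n P f pc' mem')

Runs : (n : ℕ) → Program → Mem → Mem → ℕ → List ℕ → Set
Runs n P m m' c w = ∃[ fuel ] exec n P fuel 0 m ≡ just (outcome m' c w)

space : List ℕ → ℕ
space W = length (deduplicate ℕ._≟_ W)

record CounterImpl : Set where
  field
    initP : Program
    incP  : Program
    mbitP : Program     -- result returned in register 0

data Op : Set where
  inc mbit : Op

-- Space bound shape: (1 + ⌊log₂ v⌋)², i.e. O(log(v)²) (and ≥ 1 at v ≤ 1).
logSq : ℕ → ℕ
logSq v = suc ⌊log₂ v ⌋ * suc ⌊log₂ v ⌋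

-- Correct n k C D m v W ops: starting in memory m, with counter value v
-- (number of inc's so far) and written-register history W, the remaining
-- operations 'ops' each terminate with cost ≤ C, the number of distinct
-- registers used stays ≤ C·(1+⌊log₂ v⌋)², and mbit returns j with
-- 2^j ≤ v ≤ 2^(j+1) - 1.  Only counter values v ≤ 2^(n^k) are considered
-- (v exponential in n), and mbit is only meaningful for v ≥ 1.
Correct : (n k C : ℕ) → CounterImpl → Mem → (v : ℕ) → List ℕ → List Op → Set
Correct n k C D m v W [] = Data.Unit.⊤
  where import Data.Unit
Correct n k C D m v W (inc ∷ ops) =
  suc v ≤ 2 ^ (n ^ k) →
  ∃[ m' ] ∃[ c ] ∃[ w ]
    ( Runs n (CounterImpl.incP D) m m' c w
    × c ≤ C
    × space (W ++ w) ≤ C * logSq (suc v)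
    × Correct n k C D m' (suc v) (W ++ w) ops )
Correct n k C D m v W (mbit ∷ ops) =
  1 ≤ v →
  ∃[ m' ] ∃[ c ] ∃[ w ]
    ( Runs n (CounterImpl.mbitP D) m m' c w
    × c ≤ C
    × space (W ++ w) ≤ C * logSq v
    × (∃[ j ] (m' 0 ≡ + j × 2 ^ j ≤ v × v ≤ 2 ^ (suc j) ∸ 1))
    × Correct n k C D m' v (W ++ w) ops )

CounterSpec : (n k C : ℕ) → CounterImpl → Set
CounterSpec n k C D =
  ∃[ m ] ∃[ c ] ∃[ w ]
    ( Runs n (CounterImpl.initP D) zeroMem m c w
    × c ≤ C
    × space w ≤ C * logSq 0
    × ((ops : List Op) → Correct n k C D m 0 w ops) )

{-# OPTIONS --safe #-}
-- The counter keeps v in binary, but only implicitly, through its run table: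
-- D[i] is the length of the block of ones starting at bit i when such a block
-- starts there, and 0 otherwise.  If t = D[0] is the number of trailing ones,
-- then v + 1 has zeros below bit t and a one at bit t, which joins the block
-- starting at bit t + 1; so only D[0], D[t] and D[t + 1] change, and an
-- increment is a fixed sequence of twenty instructions.  A second register
-- holds j = ⌊log₂ v⌋, which changes exactly when t = j + 1.  The increment
-- stores t at register 11 + 2(j + 1 - t) unconditionally: that is register 11
-- precisely in this case, and otherwise an odd register nobody reads.  All
-- values handled stay below 2 n^k + 20, so every instruction costs O(k), and
-- only registers below 16 + 2 ⌊log₂ v⌋ are ever written.
module Submission where

open import Defs
open import Data.Nat
open import Data.Nat.Properties
open import Data.Nat.DivMod using (_/_; m*n/n≡m; /-monoˡ-≤)
open import Data.Nat.Logarithm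
open import Data.Nat.Tactic.RingSolver using (solve-∀)
open import Data.Integer as ℤ using (ℤ; +_; ∣_∣)
import Data.Integer.Properties as ℤ
open import Data.Bool using (Bool; true; false; if_then_else_; T)
open import Data.Bool.Properties using (if-float)
open import Data.List using (List; []; _∷_; _++_; length)
open import Data.List.Relation.Unary.All as All using (All; []; _∷_)
import Data.List.Relation.Unary.All.Properties as All
open import Data.List.Relation.Unary.AllPairs using (AllPairs; []; _∷_)
open import Data.List.Relation.Unary.Unique.DecPropositional.Properties _≟_ using (deduplicate-!)
open import Data.Maybe using (Maybe; just; nothing)
open import Data.Product using (_×_; _,_; ∃-syntax)
open import Data.Sum using (_⊎_; inj₁; inj₂)
open import Data.Unit using (⊤; tt)
open import Data.Empty using (⊥; ⊥-elim)
open import Relation.Binary.PropositionalEquality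
open import Relation.Nullary using (yes; no; contradiction)
open import Relation.Nullary.Decidable using (toWitness)

-- Binary numerals and their run tables

-- Least significant bit outermost; `one` is the leading bit.
data Bin⁺ : Set where
  one : Bin⁺
  O I : Bin⁺ → Bin⁺

toℕ⁺ : Bin⁺ → ℕ
toℕ⁺ one   = 1
toℕ⁺ (O x) = 2 * toℕ⁺ x
toℕ⁺ (I x) = suc (2 * toℕ⁺ x)

msb⁺ : Bin⁺ → ℕ
msb⁺ one   = 0
msb⁺ (O x) = suc (msb⁺ x)
msb⁺ (I x) = suc (msb⁺ x)

bsuc⁺ : Bin⁺ → Bin⁺
bsuc⁺ one   = O one
bsuc⁺ (O x) = I x
bsuc⁺ (I x) = O (bsuc⁺ x)

trailingOnes⁺ : Bin⁺ → ℕ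
trailingOnes⁺ one   = 1
trailingOnes⁺ (O x) = 0
trailingOnes⁺ (I x) = suc (trailingOnes⁺ x)

-- `runLength b x i` is the length of the block of ones of x starting at bit i
-- if a block starts there, and 0 otherwise; b tells whether the bit just
-- below x is a one.
runLength : Bool → Bin⁺ → ℕ → ℕ
runLength b one   zero    = if b then 0 else 1
runLength b one   (suc i) = 0
runLength b (O x) zero    = 0
runLength b (O x) (suc i) = runLength false x i
runLength b (I x) zero    = if b then 0 else trailingOnes⁺ (I x)
runLength b (I x) (suc i) = runLength true x i

runs⁺ : Bin⁺ → ℕ → ℕ
runs⁺ = runLength false

-- The run table after an increment, given the table r before it and t = r 0.
incRuns : (ℕ → ℕ) → ℕ → ℕ → ℕ
incRuns r t i =
  if i ≡ᵇ suc t then 0 else if i ≡ᵇ t then suc (r (suc t)) else if i ≡ᵇ 0 then 0 else r i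

toℕ⁺-bsuc⁺ : ∀ x → toℕ⁺ (bsuc⁺ x) ≡ suc (toℕ⁺ x)
toℕ⁺-bsuc⁺ one   = refl
toℕ⁺-bsuc⁺ (O x) = refl
toℕ⁺-bsuc⁺ (I x) = trans (cong (2 *_) (toℕ⁺-bsuc⁺ x)) (*-suc 2 (toℕ⁺ x))

2^msb⁺≤toℕ⁺ : ∀ x → 2 ^ msb⁺ x ≤ toℕ⁺ x
2^msb⁺≤toℕ⁺ one   = ≤-refl
2^msb⁺≤toℕ⁺ (O x) = *-monoʳ-≤ 2 (2^msb⁺≤toℕ⁺ x)
2^msb⁺≤toℕ⁺ (I x) = m≤n⇒m≤1+n (*-monoʳ-≤ 2 (2^msb⁺≤toℕ⁺ x))

suc[2*m]<2*n : ∀ {m n} → m < n → suc (2 * m) < 2 * n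
suc[2*m]<2*n {m} {n} m<n = subst (_≤ 2 * n) (*-suc 2 m) (*-monoʳ-≤ 2 m<n)

toℕ⁺<2^[1+msb⁺] : ∀ x → toℕ⁺ x < 2 ^ suc (msb⁺ x)
toℕ⁺<2^[1+msb⁺] one   = ≤-refl
toℕ⁺<2^[1+msb⁺] (O x) = ≤-trans (n≤1+n _) (suc[2*m]<2*n (toℕ⁺<2^[1+msb⁺] x))
toℕ⁺<2^[1+msb⁺] (I x) = suc[2*m]<2*n (toℕ⁺<2^[1+msb⁺] x)

msb⁺-bsuc⁺ : ∀ x → (trailingOnes⁺ x ≡ suc (msb⁺ x) × msb⁺ (bsuc⁺ x) ≡ suc (msb⁺ x))
                 ⊎ (trailingOnes⁺ x ≤ msb⁺ x × msb⁺ (bsuc⁺ x) ≡ msb⁺ x)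
msb⁺-bsuc⁺ one   = inj₁ (refl , refl)
msb⁺-bsuc⁺ (O x) = inj₂ (z≤n , refl)
msb⁺-bsuc⁺ (I x) with msb⁺-bsuc⁺ x
... | inj₁ (t≡ , msb≡) = inj₁ (cong suc t≡ , cong suc msb≡)
... | inj₂ (t≤ , msb≡) = inj₂ (s≤s t≤ , cong suc msb≡)

trailingOnes⁺≤1+msb⁺ : ∀ x → trailingOnes⁺ x ≤ suc (msb⁺ x)
trailingOnes⁺≤1+msb⁺ x with msb⁺-bsuc⁺ x
... | inj₁ (t≡ , _) = ≤-reflexive t≡
... | inj₂ (t≤ , _) = m≤n⇒m≤1+n t≤

runLength≤1+msb⁺ : ∀ b x i → runLength b x i ≤ suc (msb⁺ x)
runLength≤1+msb⁺ false one   zero    = ≤-refl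
runLength≤1+msb⁺ true  one   zero    = z≤n
runLength≤1+msb⁺ b     one   (suc i) = z≤n
runLength≤1+msb⁺ b     (O x) zero    = z≤n
runLength≤1+msb⁺ b     (O x) (suc i) = m≤n⇒m≤1+n (runLength≤1+msb⁺ false x i)
runLength≤1+msb⁺ false (I x) zero    = s≤s (trailingOnes⁺≤1+msb⁺ x)
runLength≤1+msb⁺ true  (I x) zero    = z≤n
runLength≤1+msb⁺ b     (I x) (suc i) = m≤n⇒m≤1+n (runLength≤1+msb⁺ true x i)

runs⁺-zero : ∀ x → runs⁺ x 0 ≡ trailingOnes⁺ x
runs⁺-zero one   = refl
runs⁺-zero (O x) = refl
runs⁺-zero (I x) = refl

runLength-true-zero : ∀ x → runLength true x 0 ≡ 0
runLength-true-zero one   = refl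
runLength-true-zero (O x) = refl
runLength-true-zero (I x) = refl

runLength-true-suc : ∀ x i → runLength true x (suc i) ≡ runs⁺ x (suc i)
runLength-true-suc one   i = refl
runLength-true-suc (O x) i = refl
runLength-true-suc (I x) i = refl

runs⁺-bsuc⁺ : ∀ x i → runs⁺ (bsuc⁺ x) i ≡ incRuns (runs⁺ x) (trailingOnes⁺ x) i
runs⁺-bsuc⁺ one   zero                = refl
runs⁺-bsuc⁺ one   (suc zero)          = refl
runs⁺-bsuc⁺ one   (suc (suc zero))    = refl
runs⁺-bsuc⁺ one   (suc (suc (suc i))) = refl
runs⁺-bsuc⁺ (O x) zero                = cong suc (sym (runs⁺-zero x))
runs⁺-bsuc⁺ (O x) (suc zero)          = runLength-true-zero x
runs⁺-bsuc⁺ (O x) (suc (suc i))       = runLength-true-suc x i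
runs⁺-bsuc⁺ (I x) zero                = refl
runs⁺-bsuc⁺ (I x) (suc i)             = trans (runs⁺-bsuc⁺ x i) (shift i (trailingOnes⁺ x))
  where
  shift : ∀ i t → incRuns (runs⁺ x) t i ≡
          (if i ≡ᵇ suc t then 0 else if i ≡ᵇ t then suc (runLength true x (suc t)) else runLength true x i)
  shift zero    zero    = cong suc (sym (runLength-true-suc x 0))
  shift zero    (suc t) = sym (runLength-true-zero x)
  shift (suc i) t rewrite runLength-true-suc x t | runLength-true-suc x i = refl

-- Binary naturals: nothing is 0.  Note that msb 0 = 0.
Bin : Set
Bin = Maybe Bin⁺

toℕ : Bin → ℕ
toℕ nothing  = 0
toℕ (just x) = toℕ⁺ x

msb : Bin → ℕ
msb nothing  = 0
msb (just x) = msb⁺ x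

bsuc : Bin → Bin
bsuc nothing  = just one
bsuc (just x) = just (bsuc⁺ x)

trailingOnes : Bin → ℕ
trailingOnes nothing  = 0
trailingOnes (just x) = trailingOnes⁺ x

runs : Bin → ℕ → ℕ
runs nothing  i = 0
runs (just x) i = runs⁺ x i

toℕ-bsuc : ∀ x → toℕ (bsuc x) ≡ suc (toℕ x)
toℕ-bsuc nothing  = refl
toℕ-bsuc (just x) = toℕ⁺-bsuc⁺ x

msb-bsuc : ∀ x → (trailingOnes x ≡ suc (msb x) × msb (bsuc x) ≡ suc (msb x))
               ⊎ (trailingOnes x ≤ msb x × msb (bsuc x) ≡ msb x)
msb-bsuc nothing  = inj₂ (z≤n , refl)
msb-bsuc (just x) = msb⁺-bsuc⁺ x

msb≤msb-bsuc : ∀ x → msb x ≤ msb (bsuc x)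
msb≤msb-bsuc x with msb-bsuc x
... | inj₁ (_ , msb≡) = ≤-trans (n≤1+n _) (≤-reflexive (sym msb≡))
... | inj₂ (_ , msb≡) = ≤-reflexive (sym msb≡)

trailingOnes≤1+msb : ∀ x → trailingOnes x ≤ suc (msb x)
trailingOnes≤1+msb nothing  = z≤n
trailingOnes≤1+msb (just x) = trailingOnes⁺≤1+msb⁺ x

runs≤1+msb : ∀ x i → runs x i ≤ suc (msb x)
runs≤1+msb nothing  i = z≤n
runs≤1+msb (just x) i = runLength≤1+msb⁺ false x i

runs-zero : ∀ x → runs x 0 ≡ trailingOnes x
runs-zero nothing  = refl
runs-zero (just x) = runs⁺-zero x

runs-bsuc : ∀ x i → runs (bsuc x) i ≡ incRuns (runs x) (trailingOnes x) i
runs-bsuc nothing  zero          = refl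
runs-bsuc nothing  (suc zero)    = refl
runs-bsuc nothing  (suc (suc i)) = refl
runs-bsuc (just x) i             = runs⁺-bsuc⁺ x i

msb-bounds : ∀ x → 1 ≤ toℕ x → 2 ^ msb x ≤ toℕ x × toℕ x ≤ 2 ^ suc (msb x) ∸ 1
msb-bounds nothing  ()
msb-bounds (just x) _ = 2^msb⁺≤toℕ⁺ x , ≤pred (toℕ⁺<2^[1+msb⁺] x)
  where
  ≤pred : ∀ {m n} → m < n → m ≤ n ∸ 1
  ≤pred {n = suc n} (s≤s m≤n) = m≤n

2^≤⇒≤⌊log₂⌋ : ∀ {a v} → 2 ^ a ≤ v → a ≤ ⌊log₂ v ⌋
2^≤⇒≤⌊log₂⌋ {a} 2^a≤v = subst (_≤ _) (⌊log₂[2^n]⌋≡n a) (⌊log₂⌋-mono-≤ 2^a≤v)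

2^≤2^⇒≤ : ∀ {a b} → 2 ^ a ≤ 2 ^ b → a ≤ b
2^≤2^⇒≤ {b = b} 2^a≤2^b = subst (_ ≤_) (⌊log₂[2^n]⌋≡n b) (2^≤⇒≤⌊log₂⌋ 2^a≤2^b)

<2^[1+⌊log₂⌋] : ∀ v → v < 2 ^ suc ⌊log₂ v ⌋
<2^[1+⌊log₂⌋] v with 2 ^ suc ⌊log₂ v ⌋ ≤? v
... | no  2^[1+l]≰v = ≰⇒> 2^[1+l]≰v
... | yes 2^[1+l]≤v = contradiction (2^≤⇒≤⌊log₂⌋ 2^[1+l]≤v) 1+n≰n

msb≤⌊log₂toℕ⌋ : ∀ x → msb x ≤ ⌊log₂ toℕ x ⌋
msb≤⌊log₂toℕ⌋ nothing  = z≤n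
msb≤⌊log₂toℕ⌋ (just x) = 2^≤⇒≤⌊log₂⌋ (2^msb⁺≤toℕ⁺ x)

toℕ≤2^⇒msb≤ : ∀ {q} x → toℕ x ≤ 2 ^ q → msb x ≤ q
toℕ≤2^⇒msb≤ nothing  _ = z≤n
toℕ≤2^⇒msb≤ (just x) x≤2^q = 2^≤2^⇒≤ (≤-trans (2^msb⁺≤toℕ⁺ x) x≤2^q)

remove : ℕ → List ℕ → List ℕ
remove a [] = []
remove a (x ∷ xs) with x ≟ a
... | yes _ = remove a xs
... | no  _ = x ∷ remove a xs

Distinct : List ℕ → Set
Distinct = AllPairs _≢_

remove-All : ∀ {P : ℕ → Set} a {xs} → All P xs → All P (remove a xs)
remove-All a {[]}     []       = []
remove-All a {x ∷ xs} (p ∷ ps) with x ≟ a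
... | yes _ = remove-All a ps
... | no  _ = p ∷ remove-All a ps

remove-< : ∀ a {xs} → All (_< suc a) xs → All (_< a) (remove a xs)
remove-< a {[]}     []       = []
remove-< a {x ∷ xs} (p ∷ ps) with x ≟ a
... | yes _   = remove-< a ps
... | no  x≢a = ≤∧≢⇒< (s≤s⁻¹ p) x≢a ∷ remove-< a ps

remove-Distinct : ∀ a {xs} → Distinct xs → Distinct (remove a xs)
remove-Distinct a {[]}     []       = []
remove-Distinct a {x ∷ xs} (p ∷ ps) with x ≟ a
... | yes _ = remove-Distinct a ps
... | no  _ = remove-All a p ∷ remove-Distinct a ps

length-remove-absent : ∀ a {xs} → All (a ≢_) xs → length xs ≤ length (remove a xs)
length-remove-absent a {[]}     []       = z≤n
length-remove-absent a {x ∷ xs} (p ∷ ps) with x ≟ a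
... | yes x≡a = ⊥-elim (p (sym x≡a))
... | no  _   = s≤s (length-remove-absent a ps)

length≤1+length-remove : ∀ a {xs} → Distinct xs → length xs ≤ suc (length (remove a xs))
length≤1+length-remove a {[]}     []       = z≤n
length≤1+length-remove a {x ∷ xs} (p ∷ ps) with x ≟ a
... | yes refl = s≤s (length-remove-absent x p)
... | no  _    = s≤s (length≤1+length-remove a ps)

Distinct-<⇒length≤ : ∀ N {xs} → Distinct xs → All (_< N) xs → length xs ≤ N
Distinct-<⇒length≤ zero    {[]}    _ _          = z≤n
Distinct-<⇒length≤ zero    {_ ∷ _} _ (() ∷ _)
Distinct-<⇒length≤ (suc N) {xs} dxs xs<N =
  ≤-trans (length≤1+length-remove N dxs)
          (s≤s (Distinct-<⇒length≤ N (remove-Distinct N dxs) (remove-< N xs<N)))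

space≤ : ∀ N {W} → All (_< N) W → space W ≤ N
space≤ N {W} W<N = Distinct-<⇒length≤ N (deduplicate-! W) (All.deduplicate⁺ _≟_ W<N)

NotHalt : Instr → Set
NotHalt halt = ⊥
NotHalt _    = ⊤

module Execution (n : ℕ) (P : Program) (K : ℕ) where
  open StepResult

  exec-step : ∀ f pc m i → nth P pc ≡ just i → NotHalt i →
    exec n P (suc f) pc m
      ≡ addOutcome (cost (step n i pc m)) (written (step n i pc m))
                   (exec n P f (pc' (step n i pc m)) (mem' (step n i pc m)))
  exec-step f pc m (const r c) P[pc] _ rewrite P[pc] = refl
  exec-step f pc m (add r a b) P[pc] _ rewrite P[pc] = refl
  exec-step f pc m (sub r a b) P[pc] _ rewrite P[pc] = refl
  exec-step f pc m (mul r a b) P[pc] _ rewrite P[pc] = refl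
  exec-step f pc m (load r a)  P[pc] _ rewrite P[pc] = refl
  exec-step f pc m (store a b) P[pc] _ rewrite P[pc] = refl
  exec-step f pc m (jlt a b t) P[pc] _ rewrite P[pc] = refl
  exec-step f pc m (jmp t)     P[pc] _ rewrite P[pc] = refl

  -- K bounds the cost of each instruction executed.  A record rather than a
  -- Σ-type, so that unification never unfolds `exec` over the long memory
  -- terms of a trace.
  record RunsWithin (pc : ℕ) (m m' : Mem) (w : List ℕ) (steps : ℕ) : Set where
    constructor runsWithin
    field
      fuel      : ℕ
      totalCost : ℕ
      execution : exec n P fuel pc m ≡ just (outcome m' totalCost w)
      bounded   : totalCost ≤ steps * K

  runsWithin-step : ∀ {pc m m' w B i} → nth P pc ≡ just i → NotHalt i → cost (step n i pc m) ≤ K →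
    RunsWithin (pc' (step n i pc m)) (mem' (step n i pc m)) m' w B →
    RunsWithin pc m m' (written (step n i pc m) ++ w) (suc B)
  runsWithin-step {pc} {m} {i = i} P[pc] notHalt c≤K (runsWithin f c run c≤B) =
    runsWithin (suc f) _ (trans (exec-step f pc m i P[pc] notHalt) (cong (addOutcome _ _) run))
               (+-mono-≤ c≤K c≤B)

  runsWithin-step≡ : ∀ {pc m m₁ m' w B i} → nth P pc ≡ just i → NotHalt i →
    cost (step n i pc m) ≤ K → mem' (step n i pc m) ≡ m₁ →
    RunsWithin (pc' (step n i pc m)) m₁ m' w B →
    RunsWithin pc m m' (written (step n i pc m) ++ w) (suc B)
  runsWithin-step≡ {B = B} P[pc] notHalt c≤K refl = runsWithin-step {B = B} P[pc] notHalt c≤K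

  runsWithin-end : ∀ {pc m} → nth P pc ≡ nothing → RunsWithin pc m m [] 0
  runsWithin-end {pc} {m} P[pc] = runsWithin 1 0 halts z≤n
    where
    halts : exec n P 1 pc m ≡ just (outcome m 0 [])
    halts rewrite P[pc] = refl

  runsWithin⇒Runs : ∀ {m m' w B} → RunsWithin 0 m m' w B → ∃[ c ] (Runs n P m m' c w × c ≤ B * K)
  runsWithin⇒Runs (runsWithin f c run c≤B) = c , (f , run) , c≤B

update-if : ∀ m a x b → update m a x b ≡ (if a ≡ᵇ b then x else m b)
update-if m a x b with a ≡ᵇ b
... | true  = refl
... | false = refl

update-if-cong : ∀ m a x b {c y} → (a ≡ᵇ b) ≡ c → m b ≡ y → update m a x b ≡ (if c then x else y)
update-if-cong m a x b a≡ᵇb m[b] =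
  trans (update-if m a x b) (cong₂ (λ c y → if c then x else y) a≡ᵇb m[b])

update-miss : ∀ m a x b → (a ≡ᵇ b) ≡ false → update m a x b ≡ m b
update-miss m a x b a≢ᵇb = update-if-cong m a x b a≢ᵇb refl

[a+a]≡ᵇ[b+b] : ∀ a b → ((a + a) ≡ᵇ (b + b)) ≡ (b ≡ᵇ a)
[a+a]≡ᵇ[b+b] zero    zero    = refl
[a+a]≡ᵇ[b+b] zero    (suc b) = refl
[a+a]≡ᵇ[b+b] (suc a) zero    = refl
[a+a]≡ᵇ[b+b] (suc a) (suc b) rewrite +-suc a a | +-suc b b = [a+a]≡ᵇ[b+b] a b

[1+a+a]≡ᵇ[b+b] : ∀ a b → (suc (a + a) ≡ᵇ (b + b)) ≡ false
[1+a+a]≡ᵇ[b+b] a       zero    = refl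
[1+a+a]≡ᵇ[b+b] zero    (suc b) rewrite +-suc b b = refl
[1+a+a]≡ᵇ[b+b] (suc a) (suc b) rewrite +-suc a a | +-suc b b = [1+a+a]≡ᵇ[b+b] a b

[2+a+a]≡ᵇ[b+b] : ∀ a b → (suc (suc (a + a)) ≡ᵇ (b + b)) ≡ (b ≡ᵇ suc a)
[2+a+a]≡ᵇ[b+b] a b = trans (cong (λ c → suc c ≡ᵇ (b + b)) (sym (+-suc a a))) ([a+a]≡ᵇ[b+b] (suc a) b)

[a+a]≡ᵇ[1+b+b] : ∀ a b → ((a + a) ≡ᵇ suc (b + b)) ≡ false
[a+a]≡ᵇ[1+b+b] zero    b       = refl
[a+a]≡ᵇ[1+b+b] (suc a) zero    rewrite +-suc a a = refl
[a+a]≡ᵇ[1+b+b] (suc a) (suc b) rewrite +-suc a a | +-suc b b = [a+a]≡ᵇ[1+b+b] a b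

-- Cost of single instructions

module OpCost (k : ℕ) where
  a : ℕ
  a = 2 * k + 5

  opBound : ℕ
  opBound = suc (a + a)

  module _ (n : ℕ) where
    L : ℕ
    L = logn n

    instance
      L-nonZero : NonZero L
      L-nonZero = _

    wordBound : ℕ
    wordBound = 2 * n ^ k + 20

    value≤wordBound : ∀ {u} → u ≤ 2 + n ^ k → u ≤ wordBound
    value≤wordBound u≤ = ≤-trans u≤ (≤-trans (m≤n+m _ (n ^ k + 18)) (≤-reflexive (ring (n ^ k))))
      where
      ring : ∀ q → q + 18 + (2 + q) ≡ 2 * q + 20
      ring = solve-∀

    address≤wordBound : ∀ {c u} → c ≤ 18 → u ≤ suc (n ^ k) → c + (u + u) ≤ wordBound
    address≤wordBound c≤ u≤ = ≤-trans (+-mono-≤ c≤ (+-mono-≤ u≤ u≤)) (≤-reflexive (ring (n ^ k)))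
      where
      ring : ∀ q → 18 + (suc q + suc q) ≡ 2 * q + 20
      ring = solve-∀

    const≤wordBound : ∀ {c} → c ≤ 18 → c ≤ wordBound
    const≤wordBound {c} c≤ = ≤-trans (m≤m+n c 0) (address≤wordBound c≤ z≤n)

    read≤wordBound : ∀ {z u} → z ≡ + u → u ≤ wordBound → ∣ z ∣ ≤ wordBound
    read≤wordBound refl u≤ = u≤

    n≤2^[L+L] : n ≤ 2 ^ (L + L)
    n≤2^[L+L] = ≤-trans (<⇒≤ (<2^[1+⌊log₂⌋] n)) (^-monoʳ-≤ 2 (+-mono-≤ {1} {L} (s≤s z≤n) (≤1+pred ⌊log₂ n ⌋)))
      where
      ≤1+pred : ∀ m → m ≤ suc (pred m)
      ≤1+pred zero    = z≤n
      ≤1+pred (suc m) = ≤-refl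

    wordBound<2^[a*L] : suc wordBound ≤ 2 ^ (a * L)
    wordBound<2^[a*L] = begin
      suc (2 * n ^ k + 20)   ≤⟨ s≤s (+-monoˡ-≤ 20 (*-monoʳ-≤ 2 n^k≤N)) ⟩
      suc (2 * N + 20)       ≤⟨ 21+2m≤32m (m^n>0 2 ((L + L) * k)) ⟩
      2 ^ 5 * N              ≡⟨ ^-distribˡ-+-* 2 5 ((L + L) * k) ⟨
      2 ^ (5 + (L + L) * k)  ≤⟨ ^-monoʳ-≤ 2 exponent≤ ⟩
      2 ^ (a * L)            ∎
      where
      open ≤-Reasoning
      N = 2 ^ ((L + L) * k)
      n^k≤N : n ^ k ≤ N
      n^k≤N = subst (n ^ k ≤_) (^-*-assoc 2 (L + L) k) (^-monoˡ-≤ k n≤2^[L+L])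
      21+2m≤32m : ∀ {m} → 1 ≤ m → suc (2 * m + 20) ≤ 2 ^ 5 * m
      21+2m≤32m {suc m} _ = subst₂ _≤_ (lhs m) (rhs m) (+-mono-≤ (m≤m+n 23 9) (*-monoˡ-≤ m (m≤m+n 2 30)))
        where
        lhs : ∀ m → 23 + 2 * m ≡ suc (2 * suc m + 20)
        lhs = solve-∀
        rhs : ∀ m → 32 + 32 * m ≡ 2 ^ 5 * suc m
        rhs = solve-∀
      exponent≤ : 5 + (L + L) * k ≤ a * L
      exponent≤ = subst (5 + (L + L) * k ≤_) (ring L k) (+-monoˡ-≤ ((L + L) * k) (m≤m*n 5 L))
        where
        ring : ∀ L k → 5 * L + (L + L) * k ≡ (2 * k + 5) * L
        ring = solve-∀

    bits≤ : ∀ x → ∣ x ∣ ≤ wordBound → bits x ≤ a * L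
    bits≤ x x≤ = subst (bits x ≤_) (⌈log₂2^n⌉≡n (a * L)) (⌈log₂⌉-mono-≤ (≤-trans (s≤s x≤) wordBound<2^[a*L]))

    opCost≤ : ∀ x y → ∣ x ∣ ≤ wordBound → ∣ y ∣ ≤ wordBound → opCost n (bits x + bits y) ≤ opBound
    opCost≤ x y x≤ y≤ = s≤s (begin
      (bits x + bits y) / L  ≤⟨ /-monoˡ-≤ L (+-mono-≤ (bits≤ x x≤) (bits≤ y y≤)) ⟩
      (a * L + a * L) / L    ≡⟨ cong (_/ L) (*-distribʳ-+ L a a) ⟨
      (a + a) * L / L        ≡⟨ m*n/n≡m (a + a) L ⟩
      a + a                  ∎)
      where open ≤-Reasoning

    opCost₁≤ : ∀ x → ∣ x ∣ ≤ wordBound → opCost n (bits x) ≤ opBound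
    opCost₁≤ x x≤ = ≤-trans (s≤s (/-monoˡ-≤ L (m≤m+n (bits x) 0))) (opCost≤ x (+ 0) x≤ z≤n)

-- The counter

-- Register 10 + 2i holds D[i], register 11 holds ⌊log₂ v⌋, registers 2–9 are
-- scratch, and the odd registers beyond 11 absorb the ⌊log₂ v⌋ update when it
-- must not happen.  Initialisation is the empty program: the all-zero memory
-- is the table of v = 0.
incP : Program
incP = const 2 (+ 10) ∷ load 3 2 ∷ add 4 3 3 ∷ add 4 2 4 ∷ const 7 (+ 2) ∷ add 5 7 4 ∷
       load 6 5 ∷ const 7 (+ 1) ∷ add 6 7 6 ∷ const 8 (+ 11) ∷ load 9 8 ∷ add 9 7 9 ∷
       sub 9 9 3 ∷ add 9 9 9 ∷ add 9 8 9 ∷ const 7 (+ 0) ∷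
       store 2 7 ∷ store 4 6 ∷ store 5 7 ∷ store 9 3 ∷ []

mbitP : Program
mbitP = const 2 (+ 11) ∷ load 0 2 ∷ []

counter : CounterImpl
counter = record { initP = [] ; incP = incP ; mbitP = mbitP }

-- The memory of an increment with t = D[0], e = D[t + 1], j = ⌊log₂ v⌋ and
-- s = j + 1 - t: before its four stores, and at the end.
incScratch : Mem → (t e j s : ℕ) → Mem
incScratch m t e j s =
  update (update (update (update (update (update (update (update (update (update (update
  (update (update (update (update (update m 2 (+ 10)) 3 (+ t)) 4 (+ (t + t))) 4 (+ (10 + (t + t))))
  7 (+ 2)) 5 (+ (12 + (t + t)))) 6 (+ e)) 7 (+ 1)) 6 (+ suc e)) 8 (+ 11)) 9 (+ j)) 9 (+ suc j))
  9 (+ s)) 9 (+ (s + s))) 9 (+ (11 + (s + s)))) 7 (+ 0)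

incResult : Mem → (t e j s : ℕ) → Mem
incResult m t e j s =
  update (update (update (update (incScratch m t e j s) 10 (+ 0)) (10 + (t + t)) (+ suc e))
         (12 + (t + t)) (+ 0)) (11 + (s + s)) (+ t)

incScratchWrites : List ℕ
incScratchWrites = 2 ∷ 3 ∷ 4 ∷ 4 ∷ 7 ∷ 5 ∷ 6 ∷ 7 ∷ 6 ∷ 8 ∷ 9 ∷ 9 ∷ 9 ∷ 9 ∷ 9 ∷ 7 ∷ []

incWrites : (t s : ℕ) → List ℕ
incWrites t s = incScratchWrites ++ 10 ∷ (10 + (t + t)) ∷ (12 + (t + t)) ∷ (11 + (s + s)) ∷ []

+-incRuns : ∀ r t i → + incRuns r t i ≡
  (if i ≡ᵇ suc t then + 0 else if i ≡ᵇ t then + suc (r (suc t)) else if i ≡ᵇ 0 then + 0 else + r i)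
+-incRuns r t i =
  trans (if-float +_ (i ≡ᵇ suc t)) (cong (if i ≡ᵇ suc t then + 0 else_)
  (trans (if-float +_ (i ≡ᵇ t)) (cong (if i ≡ᵇ t then + suc (r (suc t)) else_)
  (if-float +_ (i ≡ᵇ 0)))))

module _ (m : Mem) (t e j s : ℕ) where
  private
    M₀ M₁ M₂ M₃ : Mem
    M₀ = incScratch m t e j s
    M₁ = update M₀ 10 (+ 0)
    M₂ = update M₁ (10 + (t + t)) (+ suc e)
    M₃ = update M₂ (12 + (t + t)) (+ 0)

  incResult-even : ∀ {y} i → m (10 + (i + i)) ≡ y → incResult m t e j s (10 + (i + i)) ≡
    (if i ≡ᵇ suc t then + 0 else if i ≡ᵇ t then + suc e else if i ≡ᵇ 0 then + 0 else y)
  incResult-even i m[b] =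
    trans (update-miss M₃ (11 + (s + s)) (+ t) b ([1+a+a]≡ᵇ[b+b] s i))
          (update-if-cong M₂ (12 + (t + t)) (+ 0) b ([2+a+a]≡ᵇ[b+b] t i)
          (update-if-cong M₁ (10 + (t + t)) (+ suc e) b ([a+a]≡ᵇ[b+b] t i)
          (update-if-cong M₀ 10 (+ 0) b ([a+a]≡ᵇ[b+b] 0 i) m[b])))
    where b = 10 + (i + i)

  incResult-odd : ∀ i → incResult m t e j s (11 + (i + i)) ≡ (if i ≡ᵇ s then + t else m (11 + (i + i)))
  incResult-odd i =
    update-if-cong M₃ (11 + (s + s)) (+ t) b ([a+a]≡ᵇ[b+b] s i)
      (trans (update-miss M₂ (12 + (t + t)) (+ 0) b ([1+a+a]≡ᵇ[b+b] t i))
      (trans (update-miss M₁ (10 + (t + t)) (+ suc e) b ([a+a]≡ᵇ[1+b+b] t i))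
             (update-miss M₀ 10 (+ 0) b refl)))
    where b = 11 + (i + i)

incResult-table : ∀ {m r} t j s → (∀ i → m (10 + (i + i)) ≡ + r i) →
  ∀ i → incResult m t (r (suc t)) j s (10 + (i + i)) ≡ + incRuns r t i
incResult-table {m} {r} t j s m-table i =
  trans (incResult-even m t (r (suc t)) j s i (m-table i)) (sym (+-incRuns r t i))

incResult-11 : ∀ {m} x → m 11 ≡ + msb x →
  incResult m (trailingOnes x) (runs x (suc (trailingOnes x))) (msb x) (suc (msb x) ∸ trailingOnes x) 11
    ≡ + msb (bsuc x)
incResult-11 {m} x m11 with msb-bsuc x | incResult-odd m t (runs x (suc t)) (msb x) (suc (msb x) ∸ t) 0
  where t = trailingOnes x
... | inj₁ (t≡ , msb≡) | read rewrite t≡ | n∸n≡0 (msb x) | msb≡ = read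
... | inj₂ (t≤ , msb≡) | read rewrite +-∸-assoc 1 t≤ | msb≡ = trans read m11

module IncRun (k n : ℕ) {m : Mem} {t e j : ℕ}
              (m10 : m 10 ≡ + t) (m[12+2t] : m (12 + (t + t)) ≡ + e) (m11 : m 11 ≡ + j)
              (t≤ : t ≤ suc j) (e≤ : e ≤ suc j) (j≤ : j ≤ n ^ k) where
  open OpCost k
  open Execution n incP opBound

  s : ℕ
  s = suc j ∸ t

  s≤ : s ≤ suc j
  s≤ = m∸n≤m (suc j) t

  value≤ : ∀ {u} → u ≤ 2 + j → u ≤ wordBound n
  value≤ u≤ = value≤wordBound n (≤-trans u≤ (s≤s (s≤s j≤)))

  address≤ : ∀ c {_ : T (c ≤ᵇ 18)} {u} → u ≤ suc j → c + (u + u) ≤ wordBound n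
  address≤ c {c≤} u≤ = address≤wordBound n (≤ᵇ⇒≤ c 18 c≤) (≤-trans u≤ (s≤s j≤))

  const≤ : ∀ c {_ : T (c ≤ᵇ 18)} → c ≤ wordBound n
  const≤ c {c≤} = const≤wordBound n (≤ᵇ⇒≤ c 18 c≤)

  t≤w : t ≤ wordBound n
  t≤w = value≤ (m≤n⇒m≤1+n t≤)

  s≤w : s ≤ wordBound n
  s≤w = value≤ (m≤n⇒m≤1+n s≤)

  e≤w : e ≤ wordBound n
  e≤w = value≤ (m≤n⇒m≤1+n e≤)

  j≤w : j ≤ wordBound n
  j≤w = value≤ (m≤n+m j 2)

  suc[j]-t : + suc j ℤ.- + t ≡ + s
  suc[j]-t = trans (ℤ.m-n≡m⊖n (suc j) t) (ℤ.⊖-≥ t≤)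

  store-phase : RunsWithin 16 (incScratch m t e j s) (incResult m t e j s)
                  (10 ∷ (10 + (t + t)) ∷ (12 + (t + t)) ∷ (11 + (s + s)) ∷ []) 4
  store-phase =
    runsWithin-step refl tt (opCost≤ n (+ 10) (+ 0) (const≤ 10) (const≤ 0)) (
    runsWithin-step refl tt (opCost≤ n (+ (10 + (t + t))) (+ suc e) (address≤ 10 t≤) (value≤ (s≤s e≤))) (
    runsWithin-step refl tt (opCost≤ n (+ (12 + (t + t))) (+ 0) (address≤ 12 t≤) (const≤ 0)) (
    runsWithin-step refl tt (opCost≤ n (+ (11 + (s + s))) (+ t) (address≤ 11 s≤) t≤w) (
    runsWithin-end refl))))

  incP-run : RunsWithin 0 m (incResult m t e j s) (incWrites t s) 20
  incP-run =
    runsWithin-step refl tt (opCost₁≤ n (+ 10) (const≤ 10)) (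
    runsWithin-step≡ refl tt (opCost≤ n (+ 10) (m 10) (const≤ 10) (read≤wordBound n m10 t≤w)) (cong (update _ 3) m10) (
    runsWithin-step refl tt (opCost≤ n (+ t) (+ t) t≤w t≤w) (
    runsWithin-step refl tt (opCost≤ n (+ 10) (+ (t + t)) (const≤ 10) (address≤ 0 t≤)) (
    runsWithin-step refl tt (opCost₁≤ n (+ 2) (const≤ 2)) (
    runsWithin-step refl tt (opCost≤ n (+ 2) (+ (10 + (t + t))) (const≤ 2) (address≤ 10 t≤)) (
    runsWithin-step≡ refl tt (opCost≤ n (+ (12 + (t + t))) (m (12 + (t + t))) (address≤ 12 t≤) (read≤wordBound n m[12+2t] e≤w))
                    (cong (update _ 6) m[12+2t]) (
    runsWithin-step refl tt (opCost₁≤ n (+ 1) (const≤ 1)) (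
    runsWithin-step refl tt (opCost≤ n (+ 1) (+ e) (const≤ 1) e≤w) (
    runsWithin-step refl tt (opCost₁≤ n (+ 11) (const≤ 11)) (
    runsWithin-step≡ refl tt (opCost≤ n (+ 11) (m 11) (const≤ 11) (read≤wordBound n m11 j≤w)) (cong (update _ 9) m11) (
    runsWithin-step refl tt (opCost≤ n (+ 1) (+ j) (const≤ 1) j≤w) (
    runsWithin-step≡ refl tt (opCost≤ n (+ suc j) (+ t) (value≤ (n≤1+n _)) t≤w) (cong (update _ 9) suc[j]-t) (
    runsWithin-step refl tt (opCost≤ n (+ s) (+ s) s≤w s≤w) (
    runsWithin-step refl tt (opCost≤ n (+ 11) (+ (s + s)) (const≤ 11) (address≤ 0 s≤)) (
    runsWithin-step refl tt (opCost₁≤ n (+ 0) (const≤ 0)) (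
    store-phase))))))))))))))))

module Correctness (k : ℕ) where
  open OpCost k

  C : ℕ
  C = 20 * opBound + 16

  registerBound : Bin → ℕ
  registerBound x = 16 + (msb x + msb x)

  record Invariant (n : ℕ) (x : Bin) (m : Mem) (W : List ℕ) : Set where
    field
      table   : ∀ i → m (10 + (i + i)) ≡ + runs x i
      msb-reg : m 11 ≡ + msb x
      written : All (_< registerBound x) W
      small   : toℕ x ≤ 2 ^ (n ^ k)

  Invariant-zero : ∀ {n} → Invariant n nothing zeroMem []
  Invariant-zero = record { table = λ _ → refl ; msb-reg = refl ; written = [] ; small = z≤n }

  space≤C*logSq : ∀ x {W} → All (_< registerBound x) W → space W ≤ C * logSq (toℕ x)
  space≤C*logSq x {W} W< = begin
    space W                        ≤⟨ space≤ _ W< ⟩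
    16 + (msb x + msb x)           ≤⟨ +-monoʳ-≤ 16 (+-mono-≤ (msb≤⌊log₂toℕ⌋ x) (msb≤⌊log₂toℕ⌋ x)) ⟩
    16 + (l + l)                   ≤⟨ +-monoʳ-≤ 16 (+-monoʳ-≤ l (m≤m+n l (14 * l))) ⟩
    16 + 16 * l                    ≡⟨ *-suc 16 l ⟨
    16 * suc l                     ≤⟨ *-monoʳ-≤ 16 (m≤m*n (suc l) (suc l)) ⟩
    16 * (suc l * suc l)           ≤⟨ *-monoˡ-≤ (suc l * suc l) (m≤n+m 16 (20 * opBound)) ⟩
    C * logSq (toℕ x)              ∎
    where
    open ≤-Reasoning
    l = ⌊log₂ toℕ x ⌋

  const<registerBound : ∀ x c {_ : T (c <ᵇ 16)} → c < registerBound x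
  const<registerBound x c {c<} = ≤-trans (<ᵇ⇒< c 16 c<) (m≤m+n 16 _)

  address<registerBound : ∀ x {c u} → c ≤ 13 → u ≤ suc (msb x) → c + (u + u) < registerBound x
  address<registerBound x {c} {u} c≤ u≤ =
    ≤-trans (s≤s (+-mono-≤ c≤ (+-mono-≤ u≤ u≤))) (≤-reflexive (ring (msb x)))
    where
    ring : ∀ j → suc (13 + (suc j + suc j)) ≡ 16 + (j + j)
    ring = solve-∀

  incRun : ∀ {n x m W} → Invariant n x m W → suc (toℕ x) ≤ 2 ^ (n ^ k) →
    ∃[ m' ] ∃[ c ] ∃[ w ] (Runs n incP m m' c w × c ≤ C × Invariant n (bsuc x) m' (W ++ w))
  incRun {n} {x} {m} {W} inv v<2^ =
    let c , run , c≤ = Execution.runsWithin⇒Runs n incP opBound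
                         (IncRun.incP-run k n m10 m[12+2t] msb-reg t≤ (runs≤1+msb x (suc t)) j≤) in
    incResult m t e j s , c , incWrites t s , run , ≤-trans c≤ (m≤m+n _ 16) , invariant
    where
    open Invariant inv
    t = trailingOnes x
    e = runs x (suc t)
    j = msb x
    s = suc j ∸ t

    t≤ : t ≤ suc j
    t≤ = trailingOnes≤1+msb x

    m10 : m 10 ≡ + t
    m10 = trans (table 0) (cong +_ (runs-zero x))

    m[12+2t] : m (12 + (t + t)) ≡ + e
    m[12+2t] = trans (cong (λ a → m (11 + a)) (sym (+-suc t t))) (table (suc t))

    j≤ : j ≤ n ^ k
    j≤ = toℕ≤2^⇒msb≤ x (≤-trans (n≤1+n _) v<2^)

    j≤j' : j ≤ msb (bsuc x)
    j≤j' = msb≤msb-bsuc x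

    new-writes : All (_< registerBound (bsuc x)) (incWrites t s)
    new-writes = All.++⁺
      (All.map (λ c< → ≤-trans c< (m≤m+n 16 _)) (toWitness {a? = All.all? (_<? 16) incScratchWrites} tt))
      (const<registerBound (bsuc x) 10 ∷
       address<registerBound (bsuc x) (≤ᵇ⇒≤ 10 13 tt) (≤-trans t≤ (s≤s j≤j')) ∷
       address<registerBound (bsuc x) (≤ᵇ⇒≤ 12 13 tt) (≤-trans t≤ (s≤s j≤j')) ∷
       address<registerBound (bsuc x) (≤ᵇ⇒≤ 11 13 tt) (≤-trans (m∸n≤m (suc j) t) (s≤s j≤j')) ∷ [])

    invariant : Invariant n (bsuc x) (incResult m t e j s) (W ++ incWrites t s)
    invariant = record
      { table   = λ i → trans (incResult-table t j s table i) (cong +_ (sym (runs-bsuc x i)))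
      ; msb-reg = incResult-11 x msb-reg
      ; written = All.++⁺ (All.map (λ w< → ≤-trans w< (+-monoʳ-≤ 16 (+-mono-≤ j≤j' j≤j'))) written)
                          new-writes
      ; small   = subst (_≤ 2 ^ (n ^ k)) (sym (toℕ-bsuc x)) v<2^
      }

  mbitRun : ∀ {n x m W} → Invariant n x m W →
    ∃[ m' ] ∃[ c ] (Runs n mbitP m m' c (2 ∷ 0 ∷ []) × c ≤ C × m' 0 ≡ + msb x
                    × Invariant n x m' (W ++ 2 ∷ 0 ∷ []))
  mbitRun {n} {x} {m} {W} inv =
    let c , run , c≤ = Execution.runsWithin⇒Runs n mbitP opBound trace in
    update (update m 2 (+ 11)) 0 (+ msb x) , c , run , ≤-trans c≤ 2*opBound≤C , refl ,
    record { table = table ; msb-reg = msb-reg ; small = small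
           ; written = All.++⁺ written (const<registerBound x 2 ∷ const<registerBound x 0 ∷ []) }
    where
    open Invariant inv
    open Execution n mbitP opBound

    11≤w : 11 ≤ wordBound n
    11≤w = const≤wordBound n (≤ᵇ⇒≤ 11 18 tt)

    msb≤w : msb x ≤ wordBound n
    msb≤w = value≤wordBound n (≤-trans (toℕ≤2^⇒msb≤ x small) (m≤n+m _ 2))

    2*opBound≤C : 2 * opBound ≤ C
    2*opBound≤C = ≤-trans (*-monoˡ-≤ opBound (≤ᵇ⇒≤ 2 20 tt)) (m≤m+n _ 16)

    trace : RunsWithin 0 m (update (update m 2 (+ 11)) 0 (+ msb x)) (2 ∷ 0 ∷ []) 2
    trace =
      runsWithin-step refl tt (opCost₁≤ n (+ 11) 11≤w) (
      runsWithin-step≡ refl tt (opCost≤ n (+ 11) (m 11) 11≤w (read≤wordBound n msb-reg msb≤w))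
                      (cong (update _ 0) msb-reg) (
      runsWithin-end refl))

  correct : ∀ {n} ops x m W → Invariant n x m W → Correct n k C counter m (toℕ x) W ops
  correct []           x m W inv      = tt
  correct {n} (inc ∷ ops) x m W inv v<2^ =
    let m' , c , w , run , c≤ , inv' = incRun inv v<2^ in
    m' , c , w , run , c≤ ,
    at-suc (λ v → space (W ++ w) ≤ C * logSq v) (space≤C*logSq (bsuc x) (Invariant.written inv')) ,
    at-suc (λ v → Correct n k C counter m' v (W ++ w) ops) (correct ops (bsuc x) m' (W ++ w) inv')
    where
    at-suc : (P : ℕ → Set) → P (toℕ (bsuc x)) → P (suc (toℕ x))
    at-suc P = subst P (toℕ-bsuc x)
  correct (mbit ∷ ops) x m W inv 1≤v  =
    let m' , c , run , c≤ , out , inv' = mbitRun inv in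
    m' , c , _ , run , c≤ , space≤C*logSq x (Invariant.written inv') ,
    (msb x , out , msb-bounds x 1≤v) , correct ops x m' _ inv'

theorem18 : ∃[ D ] ((k : ℕ) → ∃[ C ] ((n : ℕ) → 2 ≤ n → CounterSpec n k C D))
theorem18 = counter , λ k → let open Correctness k in
  C , λ n _ → zeroMem , 0 , [] , (1 , refl) , z≤n , z≤n ,
              λ ops → correct ops nothing zeroMem [] Invariant-zero
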